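{- For each $m\in\{7,10\}$, there exists an optimal $2$-D $(m\times 10,3,1)$-OOC with $J^*(m\times 10,3,1)$ codewords.
   Context: Let $I_m=\{0,1,\dots,m-1\}$ and $\mathbb{Z}_n$ the integers modulo $n$. A $2$-D $(m\times n,k,1)$-OOC is a set $\mathcal{C}$ of $k$-subsets of $I_m\times\mathbb{Z}_n$ such that $|A\cap(A+\tau)|\le 1$ for every $A\in\mathcal{C}$ and every integer $\tau\not\equiv 0\pmod n$, and $|A\cap(B+\tau)|\le 1$ for all distinct $A,B\in\mathcal{C}$ and every integer $\tau$, where $B+\tau=\{(i,x+\tau \bmod n):(i,x)\in B\}$. It is optimal if it has the maximum possible number of codewords. $J(m\times n,3,1)=\left\lfloor \frac{m}{3}\left\lfloor\frac{mn-1}{2}\right\rfloor\right\rfloor$. For even $n$, $J^*(m\times n,3,1)=J(m\times n,3,1)-1$ if $mn\equiv 14,20\pmod{24}$, or $m\equiv 4\pmod 6$ and $n=4$, or $m\equiv 5,8\pmod{12}$ and $n=2$, or $m\equiv 0\pmod 3$ and $mn\equiv 6,12\pmod{24}$; and $J^*(m\times n,3,1)=J(m\times n,3,1)$ otherwise. -}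

module Defs where

open import Data.Nat using (ℕ; zero; suc; _+_; _*_; _∸_; _≤_)
open import Data.Nat.DivMod using (_/_; _%_; _mod_)
open import Data.Bool using (Bool; true; false; _∧_; _∨_; if_then_else_)
open import Data.Fin using (Fin; toℕ)
import Data.Fin as Fin
open import Data.Product using (_×_; _,_)
open import Data.Product.Properties using (≡-dec)
open import Data.List using (List; length; map; filter; lookup)
open import Data.List.Relation.Unary.Unique.Propositional using (Unique)
open import Data.List.Membership.DecPropositional using (_∈?_)
open import Relation.Binary.PropositionalEquality using (_≡_; _≢_)
open import Relation.Binary.Definitions using (DecidableEquality)
open import Relation.Nullary.Decidable using (⌊_⌋)
import Data.Nat as ℕ

-- A point of I_m × Z_n.  Z_n is represented by Fin n with addition mod n.
Point : ℕ → ℕ → Set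
Point m n = Fin m × Fin n

_≟P_ : ∀ {m n} → DecidableEquality (Point m n)
_≟P_ = ≡-dec Fin._≟_ Fin._≟_

_+ₙ_ : ∀ {n} → Fin n → Fin n → Fin n
_+ₙ_ {suc n} x τ = (toℕ x + toℕ τ) mod suc n

shift : ∀ {m n} → Fin n → List (Point m n) → List (Point m n)
shift τ B = map (λ { (i , x) → (i , x +ₙ τ) }) B

-- |A ∩ B| for duplicate-free lists A, B
∣_∩_∣ : ∀ {m n} → List (Point m n) → List (Point m n) → ℕ
∣ A ∩ B ∣ = length (filter (λ p → _∈?_ _≟P_ p B) A)

IsKSubset : ∀ {m n} → ℕ → List (Point m n) → Set
IsKSubset k A = Unique A × length A ≡ k

record IsOOC (m n k : ℕ) (C : List (List (Point m n))) : Set where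
  field
    ksubsets : ∀ (i : Fin (length C)) → IsKSubset k (lookup C i)
    auto     : ∀ (i : Fin (length C)) (τ : Fin n) → toℕ τ ≢ 0 →
               ∣ lookup C i ∩ shift τ (lookup C i) ∣ ≤ 1
    cross    : ∀ (i j : Fin (length C)) → i ≢ j → (τ : Fin n) →
               ∣ lookup C i ∩ shift τ (lookup C j) ∣ ≤ 1

IsOptimalOOC : (m n k : ℕ) → List (List (Point m n)) → Set
IsOptimalOOC m n k C =
  IsOOC m n k C × (∀ C′ → IsOOC m n k C′ → length C′ ≤ length C)

-- J(m×n,3,1) = ⌊ (m/3) ⌊(mn−1)/2⌋ ⌋ = ⌊ m ⌊(mn−1)/2⌋ / 3 ⌋
J : ℕ → ℕ → ℕ
J m n = (m * ((m * n ∸ 1) / 2)) / 3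

private
  infix 4 _==_
  _==_ : ℕ → ℕ → Bool
  a == b = ⌊ a ℕ.≟ b ⌋

-- exceptional condition for J*, (stated for even n)
JExc : ℕ → ℕ → Bool
JExc m n =
     ((m * n) % 24 == 14) ∨ ((m * n) % 24 == 20)
  ∨ ((m % 6 == 4) ∧ (n == 4))
  ∨ (((m % 12 == 5) ∨ (m % 12 == 8)) ∧ (n == 2))
  ∨ ((m % 3 == 0) ∧ (((m * n) % 24 == 6) ∨ ((m * n) % 24 == 12)))

J* : ℕ → ℕ → ℕ
J* m n = if JExc m n then J m n ∸ 1 else J m n

-- Attach to each ordered pair (p, q) of distinct points of a codeword the
-- difference (row of q, x_q − x_p), filed under the row of p.  Two pairs with
-- the same difference are translates of each other, so the two correlation
-- conditions say exactly that, for every row r, the differences filed under r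
-- are pairwise distinct; none of them is (r, 0).  If o points of the weight-w
-- codewords lie in row r, these are (w − 1)·o distinct elements of a set of
-- size mn − 1, whence o ≤ ⌊(mn − 1)/(w − 1)⌋, and summing over the m rows gives
-- w·|C| ≤ m·⌊(mn − 1)/(w − 1)⌋.  For w = 3 this is J(m × n, 3, 1), which equals
-- J* for m ∈ {7, 10} and n = 10; explicit codes attain it, as a computation of
-- their difference lists confirms.
module Submission where

open import Defs
open import Data.Nat using (ℕ; _≤_)
open import Data.Sum using (_⊎_)
open import Data.Product using (_×_; Σ)
open import Data.List using (List; length)
open import Relation.Binary.PropositionalEquality using (_≡_)

open import Data.Bool using (if_then_else_)
open import Data.Empty using (⊥; ⊥-elim)
open import Data.Fin using (Fin; toℕ; _≟_; combine; #_)
open import Data.Fin.Patterns using (0F)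
open import Data.Fin.Properties
  using (toℕ<n; toℕ-injective; toℕ-fromℕ<; injective⇒≤; combine-injective; all?)
open import Data.List using ([]; _∷_; [_]; map; filter; concatMap; lookup; tabulate; allFin)
open import Data.List.Properties
  using (length-++; length-map; filter-++; filter-accept; filter-reject; filter-all; map-tabulate)
open import Data.List.Membership.Propositional using (_∈_; _∉_)
open import Data.List.Membership.Propositional.Properties
  using (∈-map⁺; ∈-map⁻; ∈-concat⁺′; ∈-concat⁻′; ∈-filter⁺; ∈-filter⁻; ∈-lookup; ∈-allFin)
open import Data.List.Relation.Binary.Disjoint.Propositional using (Disjoint)
open import Data.List.Relation.Unary.All as All using ([]; _∷_)
import Data.List.Relation.Unary.All.Properties as All
open import Data.List.Relation.Unary.AllPairs as AllPairs using ([]; _∷_)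
import Data.List.Relation.Unary.AllPairs.Properties as AllPairs
open import Data.List.Relation.Unary.Any using (here; there)
open import Data.List.Relation.Unary.Unique.Propositional using (Unique)
import Data.List.Relation.Unary.Unique.Propositional.Properties as Unique
import Data.List.Relation.Unary.Unique.DecPropositional as UniqueDec
open import Data.Nat using (zero; suc; pred; _+_; _*_; _∸_; _<_; s≤s; z≤n; NonZero)
import Data.Nat as ℕ
import Data.Nat.ListAction as List
open import Data.Nat.DivMod
  using (_%_; _mod_; _/_; %-distribˡ-+; m%n%n≡m%n; [m+n]%n≡m%n; m<n⇒m%n≡m; m*n/n≡m; /-monoˡ-≤)
open import Data.Nat.Properties
  using ( +-*-semiring; +-commutativeSemigroup; +-comm; +-assoc; +-identityʳ; +-mono-≤; *-zeroʳ; m+[n∸m]≡n; <⇒≤; ≰⇒>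
        ; suc-injective; <⇒≱; <⇒≤pred; pred[m∸n]≡m∸[1+n]; module ≤-Reasoning)
open import Algebra.Properties.CommutativeSemigroup +-commutativeSemigroup using (x∙yz≈y∙xz; xy∙z≈y∙xz)
open import Algebra.Properties.Semiring.Sum +-*-semiring
  using (sum-syntax; sum-cong-≗; ∑-comm; ∑-distrib-+; *-distribʳ-sum)
open import Data.Product using (_,_; proj₁; proj₂; ∃-syntax; uncurry)
open import Data.Product.Properties using (,-injectiveˡ; ,-injectiveʳ; ≡-dec)
open import Data.Sum using (inj₁; inj₂; [_,_]′)
open import Function using (_∘_)
open import Relation.Binary.Definitions using (DecidableEquality)
open import Relation.Binary.PropositionalEquality
  using (_≢_; refl; sym; trans; cong; cong₂; subst; module ≡-Reasoning)
open import Relation.Nullary using (¬_; Dec; does; yes; no; ¬?)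
open import Relation.Nullary.Decidable using (from-yes; decidable-stable; _×-dec_)

-- Arithmetic in ℤ_N

module _ {n : ℕ} where
  private
    N = suc n

    toℕ-mod : ∀ a → toℕ (a mod N) ≡ a % N
    toℕ-mod a = toℕ-fromℕ< _

    [a%N+b]%N≡[a+b]%N : ∀ a b → (a % N + b) % N ≡ (a + b) % N
    [a%N+b]%N≡[a+b]%N a b = begin
      (a % N + b) % N          ≡⟨ %-distribˡ-+ (a % N) b N ⟩
      (a % N % N + b % N) % N  ≡⟨ cong (λ c → (c + b % N) % N) (m%n%n≡m%n a N) ⟩
      (a % N + b % N) % N      ≡⟨ %-distribˡ-+ a b N ⟨
      (a + b) % N              ∎
      where open ≡-Reasoning

    [a+b%N]%N≡[a+b]%N : ∀ a b → (a + b % N) % N ≡ (a + b) % N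
    [a+b%N]%N≡[a+b]%N a b = begin
      (a + b % N) % N  ≡⟨ cong (_% N) (+-comm a (b % N)) ⟩
      (b % N + a) % N  ≡⟨ [a%N+b]%N≡[a+b]%N b a ⟩
      (b + a) % N      ≡⟨ cong (_% N) (+-comm b a) ⟩
      (a + b) % N      ∎
      where open ≡-Reasoning

    [x+[a+[N∸a]]]%N≡x : ∀ (x : Fin N) a → a < N → (toℕ x + (a + (N ∸ a))) % N ≡ toℕ x
    [x+[a+[N∸a]]]%N≡x x a a<N = begin
      (toℕ x + (a + (N ∸ a))) % N  ≡⟨ cong (λ c → (toℕ x + c) % N) (m+[n∸m]≡n (<⇒≤ a<N)) ⟩
      (toℕ x + N) % N              ≡⟨ [m+n]%n≡m%n (toℕ x) N ⟩
      toℕ x % N                    ≡⟨ m<n⇒m%n≡m (toℕ<n x) ⟩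
      toℕ x                        ∎
      where open ≡-Reasoning

  +ₙ-comm : (x y : Fin N) → x +ₙ y ≡ y +ₙ x
  +ₙ-comm x y = cong (_mod N) (+-comm (toℕ x) (toℕ y))

  +ₙ-identityʳ : (x : Fin N) → x +ₙ 0F ≡ x
  +ₙ-identityʳ x = toℕ-injective (begin
    toℕ ((toℕ x + 0) mod N)  ≡⟨ toℕ-mod (toℕ x + 0) ⟩
    (toℕ x + 0) % N          ≡⟨ cong (_% N) (+-identityʳ (toℕ x)) ⟩
    toℕ x % N                ≡⟨ m<n⇒m%n≡m (toℕ<n x) ⟩
    toℕ x                    ∎)
    where open ≡-Reasoning

  +ₙ-assoc : (x y z : Fin N) → (x +ₙ y) +ₙ z ≡ x +ₙ (y +ₙ z)
  +ₙ-assoc x y z = toℕ-injective (begin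
    toℕ ((toℕ (x +ₙ y) + c) mod N)  ≡⟨ toℕ-mod (toℕ (x +ₙ y) + c) ⟩
    (toℕ (x +ₙ y) + c) % N          ≡⟨ cong (λ d → (d + c) % N) (toℕ-mod (a + b)) ⟩
    ((a + b) % N + c) % N           ≡⟨ [a%N+b]%N≡[a+b]%N (a + b) c ⟩
    (a + b + c) % N                 ≡⟨ cong (_% N) (+-assoc a b c) ⟩
    (a + (b + c)) % N               ≡⟨ [a+b%N]%N≡[a+b]%N a (b + c) ⟨
    (a + (b + c) % N) % N           ≡⟨ cong (λ d → (a + d) % N) (toℕ-mod (b + c)) ⟨
    (a + toℕ (y +ₙ z)) % N          ≡⟨ toℕ-mod (a + toℕ (y +ₙ z)) ⟨
    toℕ ((a + toℕ (y +ₙ z)) mod N)  ∎)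
    where
    open ≡-Reasoning
    a = toℕ x
    b = toℕ y
    c = toℕ z

  +ₙ-rightComm : (x y z : Fin N) → (x +ₙ y) +ₙ z ≡ (x +ₙ z) +ₙ y
  +ₙ-rightComm x y z = begin
    (x +ₙ y) +ₙ z  ≡⟨ +ₙ-assoc x y z ⟩
    x +ₙ (y +ₙ z)  ≡⟨ cong (x +ₙ_) (+ₙ-comm y z) ⟩
    x +ₙ (z +ₙ y)  ≡⟨ +ₙ-assoc x z y ⟨
    (x +ₙ z) +ₙ y  ∎
    where open ≡-Reasoning

  -- Opaque: normalising its `mod` inside proofs is prohibitively slow.  Only the
  -- computation on the explicit codes unfolds it.
  opaque
    infixl 6 _-ₙ_
    _-ₙ_ : Fin N → Fin N → Fin N
    y -ₙ x = (toℕ y + (N ∸ toℕ x)) mod N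

    toℕ[y-ₙx] : ∀ x y → toℕ (y -ₙ x) ≡ (toℕ y + (N ∸ toℕ x)) % N
    toℕ[y-ₙx] x y = toℕ-mod (toℕ y + (N ∸ toℕ x))

  x+ₙ[y-ₙx]≡y : (x y : Fin N) → x +ₙ (y -ₙ x) ≡ y
  x+ₙ[y-ₙx]≡y x y = toℕ-injective (begin
    toℕ ((a + toℕ (y -ₙ x)) mod N)  ≡⟨ toℕ-mod (a + toℕ (y -ₙ x)) ⟩
    (a + toℕ (y -ₙ x)) % N          ≡⟨ cong (λ d → (a + d) % N) (toℕ[y-ₙx] x y) ⟩
    (a + (b + (N ∸ a)) % N) % N     ≡⟨ [a+b%N]%N≡[a+b]%N a (b + (N ∸ a)) ⟩
    (a + (b + (N ∸ a))) % N         ≡⟨ cong (_% N) (x∙yz≈y∙xz a b (N ∸ a)) ⟩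
    (b + (a + (N ∸ a))) % N         ≡⟨ [x+[a+[N∸a]]]%N≡x y a (toℕ<n x) ⟩
    b                               ∎)
    where
    open ≡-Reasoning
    a = toℕ x
    b = toℕ y

  x+ₙd≡y⇒y-ₙx≡d : ∀ x d {y} → x +ₙ d ≡ y → y -ₙ x ≡ d
  x+ₙd≡y⇒y-ₙx≡d x d refl = toℕ-injective (begin
    toℕ ((x +ₙ d) -ₙ x)           ≡⟨ toℕ[y-ₙx] x (x +ₙ d) ⟩
    (toℕ (x +ₙ d) + (N ∸ a)) % N  ≡⟨ cong (λ e → (e + (N ∸ a)) % N) (toℕ-mod (a + b)) ⟩
    ((a + b) % N + (N ∸ a)) % N   ≡⟨ [a%N+b]%N≡[a+b]%N (a + b) (N ∸ a) ⟩
    (a + b + (N ∸ a)) % N         ≡⟨ cong (_% N) (xy∙z≈y∙xz a b (N ∸ a)) ⟩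
    (b + (a + (N ∸ a))) % N       ≡⟨ [x+[a+[N∸a]]]%N≡x d a (toℕ<n x) ⟩
    b                             ∎)
    where
    open ≡-Reasoning
    a = toℕ x
    b = toℕ d

-- Translations and differences of points

module _ {m n : ℕ} where
  private
    N = suc n

  infixl 6 _⊕_
  _⊕_ : Point m N → Fin N → Point m N
  (i , x) ⊕ τ = i , x +ₙ τ

  ⊕-identityʳ : ∀ p → p ⊕ 0F ≡ p
  ⊕-identityʳ (i , x) = cong (i ,_) (+ₙ-identityʳ x)

  p⊕τ≡p⇒τ≡0 : ∀ p τ → p ⊕ τ ≡ p → τ ≡ 0F
  p⊕τ≡p⇒τ≡0 (i , x) τ eq = begin
    τ       ≡⟨ x+ₙd≡y⇒y-ₙx≡d x τ (cong proj₂ eq) ⟨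
    x -ₙ x  ≡⟨ x+ₙd≡y⇒y-ₙx≡d x 0F (+ₙ-identityʳ x) ⟩
    0F      ∎
    where open ≡-Reasoning

  diff : Point m N → Point m N → Fin m × Fin N
  diff (i , x) (j , y) = j , y -ₙ x

  diff-⊕ : ∀ p q τ → diff (p ⊕ τ) (q ⊕ τ) ≡ diff p q
  diff-⊕ (i , x) (j , y) τ = cong (j ,_) (x+ₙd≡y⇒y-ₙx≡d (x +ₙ τ) (y -ₙ x) (begin
    (x +ₙ τ) +ₙ (y -ₙ x)  ≡⟨ +ₙ-rightComm x τ (y -ₙ x) ⟩
    (x +ₙ (y -ₙ x)) +ₙ τ  ≡⟨ cong (_+ₙ τ) (x+ₙ[y-ₙx]≡y x y) ⟩
    y +ₙ τ                ∎))
    where open ≡-Reasoning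

  diff-self : ∀ p → diff p p ≡ (proj₁ p , 0F)
  diff-self (i , x) = cong (i ,_) (x+ₙd≡y⇒y-ₙx≡d x 0F (+ₙ-identityʳ x))

  diff-injectiveʳ : ∀ p {q q′} → diff p q ≡ diff p q′ → q ≡ q′
  diff-injectiveʳ (i , x) {j , y} {j′ , y′} eq = cong₂ _,_ (cong proj₁ eq) (begin
    y               ≡⟨ x+ₙ[y-ₙx]≡y x y ⟨
    x +ₙ (y -ₙ x)   ≡⟨ cong (λ d → x +ₙ proj₂ d) eq ⟩
    x +ₙ (y′ -ₙ x)  ≡⟨ x+ₙ[y-ₙx]≡y x y′ ⟩
    y′              ∎)
    where open ≡-Reasoning

  diff≡⇒translates : ∀ {p q p′ q′} → proj₁ p′ ≡ proj₁ p → diff p q ≡ diff p′ q′ →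
                     let τ = proj₂ (diff p′ p) in p′ ⊕ τ ≡ p × q′ ⊕ τ ≡ q
  diff≡⇒translates {i , x} {j , y} {.i , x′} {j′ , y′} refl eq =
    cong (i ,_) (x+ₙ[y-ₙx]≡y x′ x) , cong₂ _,_ (sym (cong proj₁ eq)) (begin
      y′ +ₙ τ                  ≡⟨ cong (_+ₙ τ) (x+ₙ[y-ₙx]≡y x′ y′) ⟨
      (x′ +ₙ (y′ -ₙ x′)) +ₙ τ  ≡⟨ +ₙ-rightComm x′ (y′ -ₙ x′) τ ⟩
      (x′ +ₙ τ) +ₙ (y′ -ₙ x′)  ≡⟨ cong₂ _+ₙ_ (x+ₙ[y-ₙx]≡y x′ x) (sym (cong proj₂ eq)) ⟩
      x +ₙ (y -ₙ x)            ≡⟨ x+ₙ[y-ₙx]≡y x y ⟩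
      y                        ∎)
    where
    open ≡-Reasoning
    τ = x -ₙ x′

-- Lists and sums

module _ {A B : Set} where

  dependentPairs : List A → (A → List B) → List (A × B)
  dependentPairs xs g = concatMap (λ x → map (x ,_) (g x)) xs

  ∈-dependentPairs⁺ : ∀ {xs g x y} → x ∈ xs → y ∈ g x → (x , y) ∈ dependentPairs xs g
  ∈-dependentPairs⁺ {g = g} x∈xs y∈gx =
    ∈-concat⁺′ (∈-map⁺ (_ ,_) y∈gx) (∈-map⁺ (λ x → map (x ,_) (g x)) x∈xs)

  ∈-dependentPairs⁻ : ∀ xs {g x y} → (x , y) ∈ dependentPairs xs g → x ∈ xs × y ∈ g x
  ∈-dependentPairs⁻ xs {g} xy∈ with ∈-concat⁻′ (map (λ x → map (x ,_) (g x)) xs) xy∈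
  ... | _ , xy∈block , block∈ with ∈-map⁻ (λ x → map (x ,_) (g x)) block∈
  ...   | _ , x∈xs , refl with ∈-map⁻ _ xy∈block
  ...     | _ , y∈gx , refl = x∈xs , y∈gx

  Unique-dependentPairs : ∀ {xs g} → Unique xs → (∀ x → Unique (g x)) → Unique (dependentPairs xs g)
  Unique-dependentPairs {xs} {g} xs! g! = Unique.concat⁺
    (All.map⁺ (All.universal (λ x → Unique.map⁺ ,-injectiveʳ (g! x)) xs))
    (AllPairs.map⁺ (AllPairs.map blocks-disjoint xs!))
    where
    blocks-disjoint : ∀ {x x′} → x ≢ x′ → Disjoint (map (x ,_) (g x)) (map (x′ ,_) (g x′))
    blocks-disjoint x≢x′ (v∈ , v∈′) with ∈-map⁻ _ v∈ | ∈-map⁻ _ v∈′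
    ... | _ , _ , refl | _ , _ , eq = x≢x′ (,-injectiveˡ eq)

  length-dependentPairs : ∀ xs {g} → length (dependentPairs xs g) ≡ List.sum (map (length ∘ g) xs)
  length-dependentPairs []           = refl
  length-dependentPairs (x ∷ xs) {g} = trans (length-++ (map (x ,_) (g x)))
    (cong₂ _+_ (length-map (x ,_) (g x)) (length-dependentPairs xs))

module _ {A : Set} (_≟_ : DecidableEquality A) where

  others : A → List A → List A
  others x = filter (λ y → ¬? (y ≟ x))

  length-others : ∀ {x xs} → Unique xs → x ∈ xs → suc (length (others x xs)) ≡ length xs
  length-others {x} {x ∷ xs} (x∉xs ∷ _) (here refl) = cong (suc ∘ length) (begin
    filter (λ y → ¬? (y ≟ x)) (x ∷ xs)  ≡⟨ filter-reject (λ y → ¬? (y ≟ x)) (λ x≢x → x≢x refl) ⟩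
    filter (λ y → ¬? (y ≟ x)) xs        ≡⟨ filter-all (λ y → ¬? (y ≟ x)) (All.map (λ x≢y → x≢y ∘ sym) x∉xs) ⟩
    xs                                  ∎)
    where open ≡-Reasoning
  length-others {x} {y ∷ xs} (y∉xs ∷ xs!) (there x∈xs) = begin
    suc (length (filter (λ z → ¬? (z ≟ x)) (y ∷ xs)))
      ≡⟨ cong (suc ∘ length) (filter-accept (λ z → ¬? (z ≟ x)) (All.lookup y∉xs x∈xs)) ⟩
    suc (suc (length (others x xs)))
      ≡⟨ cong suc (length-others xs! x∈xs) ⟩
    suc (length xs)
      ∎
    where open ≡-Reasoning

module _ {A : Set} where

  sum-map-const : ∀ {xs : List A} {f c} → (∀ {x} → x ∈ xs → f x ≡ c) →
                  List.sum (map f xs) ≡ length xs * c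
  sum-map-const {[]}     _   = refl
  sum-map-const {x ∷ xs} f≡c = cong₂ _+_ (f≡c (here refl)) (sum-map-const (f≡c ∘ there))

  Unique-map-injectiveOn : ∀ {B : Set} {f : A → B} {xs} →
                           (∀ {x y} → x ∈ xs → y ∈ xs → f x ≡ f y → x ≡ y) →
                           Unique xs → Unique (map f xs)
  Unique-map-injectiveOn {xs = []}     _   []           = []
  Unique-map-injectiveOn {xs = x ∷ xs} inj (x∉xs ∷ xs!) =
    All.map⁺ (All.tabulate (λ y∈xs fx≡fy → All.lookup x∉xs y∈xs (inj (here refl) (there y∈xs) fx≡fy)))
    ∷ Unique-map-injectiveOn (λ x∈ y∈ → inj (there x∈) (there y∈)) xs!

  Unique-map⇒≢ : ∀ {B : Set} {f : A → B} {xs x y} → Unique (map f xs) →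
                 x ∈ xs → y ∈ xs → x ≢ y → f x ≢ f y
  Unique-map⇒≢ {xs = _ ∷ _} _ (here refl) (here refl) x≢y _ = x≢y refl
  Unique-map⇒≢ {f = f} {xs = _ ∷ _} (fx∉ ∷ _) (here refl) (there y∈) _ =
    All.lookup fx∉ (∈-map⁺ f y∈)
  Unique-map⇒≢ {f = f} {xs = _ ∷ _} (fy∉ ∷ _) (there x∈) (here refl) _ fx≡fy =
    All.lookup fy∉ (∈-map⁺ f x∈) (sym fx≡fy)
  Unique-map⇒≢ {xs = _ ∷ _} (_ ∷ fxs!) (there x∈) (there y∈) = Unique-map⇒≢ fxs! x∈ y∈

  Unique⇒lookup-injective : ∀ {xs : List A} → Unique xs → ∀ {i j} → lookup xs i ≡ lookup xs j → i ≡ j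
  Unique⇒lookup-injective {_ ∷ _} _          {Fin.zero}  {Fin.zero}  _  = refl
  Unique⇒lookup-injective {_ ∷ _} (x∉xs ∷ _) {Fin.zero}  {Fin.suc j} eq =
    ⊥-elim (All.lookup x∉xs (∈-lookup j) eq)
  Unique⇒lookup-injective {_ ∷ _} (x∉xs ∷ _) {Fin.suc i} {Fin.zero}  eq =
    ⊥-elim (All.lookup x∉xs (∈-lookup i) (sym eq))
  Unique⇒lookup-injective {_ ∷ _} (_ ∷ xs!)  {Fin.suc i} {Fin.suc j} eq =
    cong Fin.suc (Unique⇒lookup-injective xs! eq)

  2≤length : ∀ {x y : A} {xs} → x ∈ xs → y ∈ xs → x ≢ y → 2 ≤ length xs
  2≤length {xs = _ ∷ _ ∷ _} _           _           _   = s≤s (s≤s z≤n)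
  2≤length {xs = _ ∷ []}    (here refl) (here refl) x≢y = ⊥-elim (x≢y refl)
  2≤length {xs = _ ∷ []}    (there ())  _           _
  2≤length {xs = _ ∷ []}    _           (there ())  _

  2≤length⇒distinct : ∀ {xs : List A} → Unique xs → 2 ≤ length xs → ∃[ x ] ∃[ y ] x ∈ xs × y ∈ xs × x ≢ y
  2≤length⇒distinct {xs = x ∷ y ∷ _} ((x≢y ∷ _) ∷ _) _ = x , y , here refl , there (here refl) , x≢y
  2≤length⇒distinct {xs = _ ∷ []}    _               (s≤s ())

Unique⇒length≤ : ∀ {n} {xs : List (Fin n)} → Unique xs → length xs ≤ n
Unique⇒length≤ xs! = injective⇒≤ (Unique⇒lookup-injective xs!)

Unique⇒length≤-× : ∀ {a b} {xs : List (Fin a × Fin b)} → Unique xs → length xs ≤ a * b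
Unique⇒length≤-× {xs = xs} xs! =
  subst (_≤ _) (length-map (uncurry combine) xs) (Unique⇒length≤ (Unique.map⁺ combine-injective′ xs!))
  where
  combine-injective′ : ∀ {x y} → uncurry combine x ≡ uncurry combine y → x ≡ y
  combine-injective′ {i , j} {k , l} eq with combine-injective i j k l eq
  ... | refl , refl = refl

sum-allFin : ∀ {n} (f : Fin n → ℕ) → List.sum (map f (allFin n)) ≡ ∑[ i < n ] f i
sum-allFin {n} f = trans (cong List.sum (map-tabulate (λ i → i) f)) (sum-tabulate n f)
  where
  sum-tabulate : ∀ n (f : Fin n → ℕ) → List.sum (tabulate f) ≡ ∑[ i < n ] f i
  sum-tabulate zero    f = refl
  sum-tabulate (suc n) f = cong (f Fin.zero +_) (sum-tabulate n (f ∘ Fin.suc))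

∑-const : ∀ n c → ∑[ i < n ] c ≡ n * c
∑-const zero    c = refl
∑-const (suc n) c = cong (c +_) (∑-const n c)

∑-≤-const : ∀ {n} {f : Fin n → ℕ} {c} → (∀ i → f i ≤ c) → ∑[ i < n ] f i ≤ n * c
∑-≤-const {zero}  f≤c = z≤n
∑-≤-const {suc n} f≤c = +-mono-≤ (f≤c Fin.zero) (∑-≤-const (f≤c ∘ Fin.suc))

∑-indicator : ∀ {m} (i : Fin m) → ∑[ r < m ] (if does (i ≟ r) then 1 else 0) ≡ 1
∑-indicator {suc m} Fin.zero    = cong suc (trans (∑-const m 0) (*-zeroʳ m))
∑-indicator {suc m} (Fin.suc i) = ∑-indicator i

∑-count : ∀ {A : Set} {m} (g : A → Fin m) xs → ∑[ r < m ] length (filter (λ x → g x ≟ r) xs) ≡ length xs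
∑-count {m = m} g []       = trans (∑-const m 0) (*-zeroʳ m)
∑-count {m = m} g (x ∷ xs) = begin
  ∑[ r < m ] count r (x ∷ xs)                       ≡⟨ sum-cong-≗ split ⟩
  ∑[ r < m ] (count r [ x ] + count r xs)           ≡⟨ ∑-distrib-+ (λ r → count r [ x ]) (λ r → count r xs) ⟩
  ∑[ r < m ] count r [ x ] + ∑[ r < m ] count r xs  ≡⟨ cong₂ _+_ (trans (sum-cong-≗ singleton) (∑-indicator (g x)))
                                                                 (∑-count g xs) ⟩
  suc (length xs)                                   ∎
  where
  open ≡-Reasoning
  P? = λ r x → g x ≟ r
  count = λ r xs → length (filter (P? r) xs)
  split : ∀ r → count r (x ∷ xs) ≡ count r [ x ] + count r xs
  split r = trans (cong length (filter-++ (P? r) [ x ] xs)) (length-++ (filter (P? r) [ x ]))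
  singleton : ∀ r → count r [ x ] ≡ (if does (g x ≟ r) then 1 else 0)
  singleton r with g x ≟ r
  ... | yes _ = refl
  ... | no _  = refl

*≤⇒≤/ : ∀ {a b} d .{{_ : NonZero d}} → a * d ≤ b → a ≤ b / d
*≤⇒≤/ {a} {b} d ad≤b = begin
  a          ≡⟨ m*n/n≡m a d ⟨
  a * d / d  ≤⟨ /-monoˡ-≤ d ad≤b ⟩
  b / d      ∎
  where open ≤-Reasoning

-- Row differences of a code

module _ {m n : ℕ} where
  private
    N = suc n
    P = Point m N
    Code = List (List P)

  inRow : Fin m → List P → List P
  inRow r = filter (λ p → proj₁ p ≟ r)

  pairsInRow : Fin m → List P → List (P × P)
  pairsInRow r A = dependentPairs (inRow r A) (λ p → others _≟P_ p A)

  -- Tagged with the index of their codeword, so that the same pair of points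
  -- in two codewords is counted twice.
  rowPairs : Fin m → (C : Code) → List (Fin (length C) × P × P)
  rowPairs r C = dependentPairs (allFin (length C)) (λ i → pairsInRow r (lookup C i))

  diffOf : ∀ {c} → Fin c × P × P → Fin m × Fin N
  diffOf (_ , p , q) = diff p q

  rowDiffs : Fin m → Code → List (Fin m × Fin N)
  rowDiffs r C = map diffOf (rowPairs r C)

  ∈-rowPairs⁺ : ∀ {r C i p q} → proj₁ p ≡ r → p ∈ lookup C i → q ∈ lookup C i → q ≢ p →
                (i , p , q) ∈ rowPairs r C
  ∈-rowPairs⁺ p∈r p∈A q∈A q≢p =
    ∈-dependentPairs⁺ (∈-allFin _) (∈-dependentPairs⁺ (∈-filter⁺ _ p∈A p∈r) (∈-filter⁺ _ q∈A q≢p))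

  ∈-rowPairs⁻ : ∀ {r C i p q} → (i , p , q) ∈ rowPairs r C →
                proj₁ p ≡ r × p ∈ lookup C i × q ∈ lookup C i × q ≢ p
  ∈-rowPairs⁻ {C = C} ipq∈ =
    let _ , pq∈ = ∈-dependentPairs⁻ (allFin (length C)) ipq∈
        p∈ , q∈ = ∈-dependentPairs⁻ _ pq∈
        p∈A , p∈r = ∈-filter⁻ _ p∈
        q∈A , q≢p = ∈-filter⁻ _ q∈
    in p∈r , p∈A , q∈A , q≢p

  Unique-rowPairs : ∀ {r C} → (∀ i → Unique (lookup C i)) → Unique (rowPairs r C)
  Unique-rowPairs {C = C} C! = Unique-dependentPairs (Unique.allFin⁺ (length C))
    (λ i → Unique-dependentPairs (Unique.filter⁺ _ (C! i)) (λ _ → Unique.filter⁺ _ (C! i)))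

  origin∉rowDiffs : ∀ {r C} → (r , 0F) ∉ rowDiffs r C
  origin∉rowDiffs {r} {C} t∈ =
    let (_ , p , q) , ipq∈ , o≡pq = ∈-map⁻ diffOf t∈
        p∈r , _ , _ , q≢p = ∈-rowPairs⁻ {C = C} ipq∈
    in q≢p (diff-injectiveʳ p (begin
      diff p q        ≡⟨ o≡pq ⟨
      (r , 0F)        ≡⟨ cong (_, 0F) p∈r ⟨
      (proj₁ p , 0F)  ≡⟨ diff-self p ⟨
      diff p p        ∎))
    where open ≡-Reasoning

  2≤∣∩∣ : ∀ {A B : List P} {p q} → p ∈ A → q ∈ A → p ≢ q → p ∈ B → q ∈ B → 2 ≤ ∣ A ∩ B ∣
  2≤∣∩∣ p∈A q∈A p≢q p∈B q∈B = 2≤length (∈-filter⁺ _ p∈A p∈B) (∈-filter⁺ _ q∈A q∈B) p≢q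

  sameDiff⇒twoCommon : ∀ {r C i j p q p′ q′} → (i , p , q) ∈ rowPairs r C → (j , p′ , q′) ∈ rowPairs r C →
                       diff p q ≡ diff p′ q′ →
                       let τ = proj₂ (diff p′ p) in p′ ⊕ τ ≡ p × 2 ≤ ∣ lookup C i ∩ shift τ (lookup C j) ∣
  sameDiff⇒twoCommon {C = C} {i} {j} {p} {q} {p′} {q′} ipq∈ jpq∈′ eq =
    let p∈r , p∈A , q∈A , q≢p = ∈-rowPairs⁻ {C = C} ipq∈
        p′∈r , p′∈B , q′∈B , _ = ∈-rowPairs⁻ {C = C} jpq∈′
        p′⊕τ≡p , q′⊕τ≡q = diff≡⇒translates {p = p} {q} {p′} {q′} (trans p′∈r (sym p∈r)) eq
    in p′⊕τ≡p , 2≤∣∩∣ p∈A q∈A (q≢p ∘ sym)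
         (subst (_∈ B+τ) p′⊕τ≡p (∈-map⁺ (_⊕ τ) p′∈B)) (subst (_∈ B+τ) q′⊕τ≡q (∈-map⁺ (_⊕ τ) q′∈B))
    where
    τ = proj₂ (diff p′ p)
    B+τ = shift τ (lookup C j)

  twoCommon⇒trivial : ∀ {k C i j τ} → IsOOC m N k C → 2 ≤ ∣ lookup C i ∩ shift τ (lookup C j) ∣ →
                      i ≡ j × τ ≡ 0F
  twoCommon⇒trivial {C = C} {i} {j} {τ} ooc two = i≡j , toℕ-injective τ≡0
    where
    open IsOOC ooc
    i≡j : i ≡ j
    i≡j = decidable-stable (i ≟ j) (λ i≢j → <⇒≱ two (cross i j i≢j τ))
    τ≡0 : toℕ τ ≡ 0
    τ≡0 = decidable-stable (toℕ τ ℕ.≟ 0) λ τ≢0 →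
      <⇒≱ (subst (λ j → 2 ≤ ∣ lookup C i ∩ shift τ (lookup C j) ∣) (sym i≡j) two) (auto i τ τ≢0)

  IsOOC⇒uniqueRowDiffs : ∀ {k C} → IsOOC m N k C → ∀ r → Unique (rowDiffs r C)
  IsOOC⇒uniqueRowDiffs {C = C} ooc r =
    Unique-map-injectiveOn injective (Unique-rowPairs {r = r} {C} (proj₁ ∘ IsOOC.ksubsets ooc))
    where
    injective : ∀ {x y} → x ∈ rowPairs r C → y ∈ rowPairs r C → diffOf x ≡ diffOf y → x ≡ y
    injective {i , p , q} {j , p′ , q′} x∈ y∈ eq =
      let p′⊕τ≡p , two = sameDiff⇒twoCommon {C = C} x∈ y∈ eq
          i≡j , τ≡0 = twoCommon⇒trivial ooc two
          p′≡p = trans (sym (⊕-identityʳ p′)) (trans (cong (p′ ⊕_) (sym τ≡0)) p′⊕τ≡p)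
      in cong₂ _,_ i≡j (cong₂ _,_ (sym p′≡p) (diff-injectiveʳ p (trans eq (cong (λ p → diff p q′) p′≡p))))

  uniqueRowDiffs⇒common≤1 : ∀ {C i j τ} → (∀ r → Unique (rowDiffs r C)) → Unique (lookup C i) →
                            i ≢ j ⊎ toℕ τ ≢ 0 → ∣ lookup C i ∩ shift τ (lookup C j) ∣ ≤ 1
  uniqueRowDiffs⇒common≤1 {C} {i} {j} {τ} D! A! nontrivial =
    decidable-stable (_ ℕ.≤? 1) (no-two ∘ ≰⇒>)
    where
    A = lookup C i
    B = lookup C j

    no-two : ¬ (2 ≤ ∣ A ∩ shift τ B ∣)
    no-two two =
      let u , v , u∈ , v∈ , u≢v = 2≤length⇒distinct (Unique.filter⁺ _ A!) two
          u∈A , u∈B+τ = ∈-filter⁻ _ u∈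
          v∈A , v∈B+τ = ∈-filter⁻ _ v∈
      in collision (∈-map⁻ (_⊕ τ) u∈B+τ) (∈-map⁻ (_⊕ τ) v∈B+τ) u∈A v∈A u≢v
      where
      collision : ∀ {u v} → ∃[ b ] b ∈ B × u ≡ b ⊕ τ → ∃[ b′ ] b′ ∈ B × v ≡ b′ ⊕ τ →
                  u ∈ A → v ∈ A → u ≢ v → ⊥
      collision (b , b∈B , refl) (b′ , b′∈B , refl) u∈A v∈A u≢v =
        Unique-map⇒≢ (D! (proj₁ b)) iuv∈ jbb′∈ distinct (diff-⊕ b b′ τ)
        where
        iuv∈ : (i , b ⊕ τ , b′ ⊕ τ) ∈ rowPairs (proj₁ b) C
        iuv∈ = ∈-rowPairs⁺ {C = C} refl u∈A v∈A (u≢v ∘ sym)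
        jbb′∈ : (j , b , b′) ∈ rowPairs (proj₁ b) C
        jbb′∈ = ∈-rowPairs⁺ {C = C} refl b∈B b′∈B (λ b′≡b → u≢v (cong (_⊕ τ) (sym b′≡b)))
        distinct : (i , b ⊕ τ , b′ ⊕ τ) ≢ (j , b , b′)
        distinct eq = [ (λ i≢j → i≢j (,-injectiveˡ eq))
                      , (λ τ≢0 → τ≢0 (cong toℕ (p⊕τ≡p⇒τ≡0 b τ (,-injectiveˡ (,-injectiveʳ eq)))))
                      ]′ nontrivial

  uniqueRowDiffs⇒IsOOC : ∀ {k C} → (∀ i → IsKSubset k (lookup C i)) → (∀ r → Unique (rowDiffs r C)) →
                         IsOOC m N k C
  uniqueRowDiffs⇒IsOOC {C = C} ks D! = record
    { ksubsets = ks
    ; auto     = λ i τ τ≢0 → uniqueRowDiffs⇒common≤1 {C} {i} {i} {τ} D! (proj₁ (ks i)) (inj₂ τ≢0)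
    ; cross    = λ i j i≢j τ → uniqueRowDiffs⇒common≤1 {C} {i} {j} {τ} D! (proj₁ (ks i)) (inj₁ i≢j)
    }

  -- The Johnson bound

  occupancy : Fin m → Code → ℕ
  occupancy r C = ∑[ i < length C ] length (inRow r (lookup C i))

  length-pairsInRow : ∀ {k r A} → IsKSubset (2 + k) A → length (pairsInRow r A) ≡ length (inRow r A) * suc k
  length-pairsInRow {r = r} {A} (A! , |A|≡2+k) = trans (length-dependentPairs (inRow r A))
    (sum-map-const (λ p∈ → suc-injective (trans (length-others _≟P_ A! (proj₁ (∈-filter⁻ _ p∈))) |A|≡2+k)))

  length-rowDiffs : ∀ {k r C} → (∀ i → IsKSubset (2 + k) (lookup C i)) →
                    length (rowDiffs r C) ≡ occupancy r C * suc k
  length-rowDiffs {k} {r} {C} ks = begin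
    length (rowDiffs r C)                                ≡⟨ length-map diffOf (rowPairs r C) ⟩
    length (rowPairs r C)                                ≡⟨ length-dependentPairs (allFin (length C)) ⟩
    List.sum (map (length ∘ pairs) (allFin (length C)))  ≡⟨ sum-allFin (length ∘ pairs) ⟩
    ∑[ i < length C ] length (pairs i)                   ≡⟨ sum-cong-≗ (length-pairsInRow ∘ ks) ⟩
    ∑[ i < length C ] (occ i * suc k)                    ≡⟨ *-distribʳ-sum (suc k) occ ⟨
    occupancy r C * suc k                                ∎
    where
    open ≡-Reasoning
    pairs = λ i → pairsInRow r (lookup C i)
    occ = λ i → length (inRow r (lookup C i))

  ∑-occupancy : ∀ {k C} → (∀ i → IsKSubset k (lookup C i)) → ∑[ r < m ] occupancy r C ≡ length C * k
  ∑-occupancy {k} {C} ks = begin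
    ∑[ r < m ] ∑[ i < length C ] occ r i  ≡⟨ ∑-comm occ ⟩
    ∑[ i < length C ] ∑[ r < m ] occ r i  ≡⟨ sum-cong-≗ (λ i → trans (∑-count proj₁ (lookup C i)) (proj₂ (ks i))) ⟩
    ∑[ i < length C ] k                   ≡⟨ ∑-const (length C) k ⟩
    length C * k                          ∎
    where
    open ≡-Reasoning
    occ = λ r i → length (inRow r (lookup C i))

  occupancy-bound : ∀ {k C} → IsOOC m N (2 + k) C → ∀ r → occupancy r C ≤ (m * N ∸ 1) / suc k
  occupancy-bound {k} {C} ooc r = *≤⇒≤/ (suc k) (begin
    occupancy r C * suc k  ≡⟨ length-rowDiffs {k} {r} {C} (IsOOC.ksubsets ooc) ⟨
    length (rowDiffs r C)  ≤⟨ <⇒≤pred (Unique⇒length≤-× origin∷rowDiffs!) ⟩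
    pred (m * N)           ≡⟨ pred[m∸n]≡m∸[1+n] (m * N) 0 ⟩
    m * N ∸ 1              ∎)
    where
    open ≤-Reasoning
    origin∷rowDiffs! : Unique ((r , 0F) ∷ rowDiffs r C)
    origin∷rowDiffs! = All.¬Any⇒All¬ (rowDiffs r C) (origin∉rowDiffs {r} {C}) ∷ IsOOC⇒uniqueRowDiffs ooc r

  johnson-bound : ∀ {k C} → IsOOC m N (2 + k) C → length C ≤ m * ((m * N ∸ 1) / suc k) / (2 + k)
  johnson-bound {k} {C} ooc = *≤⇒≤/ (2 + k) (begin
    length C * (2 + k)         ≡⟨ ∑-occupancy {C = C} (IsOOC.ksubsets ooc) ⟨
    ∑[ r < m ] occupancy r C   ≤⟨ ∑-≤-const (occupancy-bound {k} {C} ooc) ⟩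
    m * ((m * N ∸ 1) / suc k)  ∎)
    where open ≤-Reasoning

meetsJ⇒optimal : ∀ {m n C} → IsOOC m (suc n) 3 C → length C ≡ J m (suc n) → IsOptimalOOC m (suc n) 3 C
meetsJ⇒optimal {C = C} ooc |C|≡J = ooc , λ C′ ooc′ → subst (length C′ ≤_) (sym |C|≡J) (johnson-bound ooc′)

-- The two codes

ksubsets? : ∀ {m n} k (C : List (List (Point m n))) → Dec (∀ i → IsKSubset k (lookup C i))
ksubsets? k C = all? λ i → UniqueDec.unique? _≟P_ (lookup C i) ×-dec (length (lookup C i) ℕ.≟ k)

uniqueRowDiffs? : ∀ {m n} (C : List (List (Point m (suc n)))) → Dec (∀ r → Unique (rowDiffs r C))
uniqueRowDiffs? C = all? λ r → UniqueDec.unique? (≡-dec _≟_ _≟_) (rowDiffs r C)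

c7 : List (List (Point 7 10))
c7 =
    ((# 2 , # 0) ∷ (# 3 , # 0) ∷ (# 6 , # 5) ∷ []) ∷
    ((# 2 , # 0) ∷ (# 3 , # 1) ∷ (# 3 , # 2) ∷ []) ∷
    ((# 0 , # 0) ∷ (# 1 , # 5) ∷ (# 1 , # 6) ∷ []) ∷
    ((# 1 , # 0) ∷ (# 1 , # 2) ∷ (# 4 , # 4) ∷ []) ∷
    ((# 1 , # 0) ∷ (# 2 , # 8) ∷ (# 5 , # 4) ∷ []) ∷
    ((# 0 , # 0) ∷ (# 2 , # 5) ∷ (# 5 , # 5) ∷ []) ∷
    ((# 2 , # 0) ∷ (# 4 , # 9) ∷ (# 5 , # 9) ∷ []) ∷
    ((# 1 , # 0) ∷ (# 2 , # 9) ∷ (# 3 , # 2) ∷ []) ∷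
    ((# 0 , # 0) ∷ (# 4 , # 0) ∷ (# 4 , # 3) ∷ []) ∷
    ((# 1 , # 0) ∷ (# 4 , # 5) ∷ (# 6 , # 3) ∷ []) ∷
    ((# 0 , # 0) ∷ (# 0 , # 1) ∷ (# 5 , # 2) ∷ []) ∷
    ((# 1 , # 0) ∷ (# 1 , # 3) ∷ (# 2 , # 7) ∷ []) ∷
    ((# 5 , # 0) ∷ (# 6 , # 1) ∷ (# 6 , # 2) ∷ []) ∷
    ((# 1 , # 0) ∷ (# 4 , # 6) ∷ (# 6 , # 2) ∷ []) ∷
    ((# 0 , # 0) ∷ (# 2 , # 6) ∷ (# 6 , # 7) ∷ []) ∷
    ((# 1 , # 0) ∷ (# 4 , # 7) ∷ (# 5 , # 5) ∷ []) ∷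
    ((# 0 , # 0) ∷ (# 0 , # 2) ∷ (# 3 , # 0) ∷ []) ∷
    ((# 2 , # 0) ∷ (# 5 , # 2) ∷ (# 6 , # 9) ∷ []) ∷
    ((# 0 , # 0) ∷ (# 4 , # 2) ∷ (# 5 , # 7) ∷ []) ∷
    ((# 1 , # 0) ∷ (# 1 , # 4) ∷ (# 3 , # 0) ∷ []) ∷
    ((# 2 , # 0) ∷ (# 5 , # 4) ∷ (# 5 , # 5) ∷ []) ∷
    ((# 3 , # 0) ∷ (# 5 , # 2) ∷ (# 6 , # 2) ∷ []) ∷
    ((# 0 , # 0) ∷ (# 1 , # 7) ∷ (# 2 , # 7) ∷ []) ∷
    ((# 1 , # 0) ∷ (# 3 , # 1) ∷ (# 6 , # 0) ∷ []) ∷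
    ((# 0 , # 0) ∷ (# 0 , # 3) ∷ (# 2 , # 2) ∷ []) ∷
    ((# 2 , # 0) ∷ (# 3 , # 4) ∷ (# 6 , # 0) ∷ []) ∷
    ((# 3 , # 0) ∷ (# 5 , # 4) ∷ (# 6 , # 8) ∷ []) ∷
    ((# 1 , # 0) ∷ (# 5 , # 0) ∷ (# 6 , # 5) ∷ []) ∷
    ((# 3 , # 0) ∷ (# 5 , # 5) ∷ (# 5 , # 9) ∷ []) ∷
    ((# 2 , # 0) ∷ (# 3 , # 5) ∷ (# 4 , # 6) ∷ []) ∷
    ((# 2 , # 0) ∷ (# 5 , # 8) ∷ (# 6 , # 7) ∷ []) ∷
    ((# 1 , # 0) ∷ (# 5 , # 1) ∷ (# 6 , # 9) ∷ []) ∷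
    ((# 0 , # 0) ∷ (# 1 , # 8) ∷ (# 2 , # 3) ∷ []) ∷
    ((# 1 , # 0) ∷ (# 3 , # 3) ∷ (# 3 , # 9) ∷ []) ∷
    ((# 1 , # 0) ∷ (# 2 , # 1) ∷ (# 4 , # 9) ∷ []) ∷
    ((# 0 , # 0) ∷ (# 4 , # 7) ∷ (# 6 , # 2) ∷ []) ∷
    ((# 0 , # 0) ∷ (# 0 , # 4) ∷ (# 4 , # 5) ∷ []) ∷
    ((# 0 , # 0) ∷ (# 4 , # 8) ∷ (# 5 , # 0) ∷ []) ∷
    ((# 2 , # 0) ∷ (# 3 , # 7) ∷ (# 5 , # 3) ∷ []) ∷
    ((# 1 , # 0) ∷ (# 3 , # 4) ∷ (# 5 , # 7) ∷ []) ∷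
    ((# 1 , # 0) ∷ (# 2 , # 2) ∷ (# 3 , # 8) ∷ []) ∷
    ((# 1 , # 0) ∷ (# 3 , # 5) ∷ (# 4 , # 1) ∷ []) ∷
    ((# 1 , # 0) ∷ (# 5 , # 8) ∷ (# 6 , # 1) ∷ []) ∷
    ((# 4 , # 0) ∷ (# 4 , # 1) ∷ (# 5 , # 7) ∷ []) ∷
    ((# 0 , # 0) ∷ (# 1 , # 9) ∷ (# 5 , # 8) ∷ []) ∷
    ((# 0 , # 0) ∷ (# 3 , # 1) ∷ (# 6 , # 8) ∷ []) ∷
    ((# 2 , # 0) ∷ (# 3 , # 8) ∷ (# 6 , # 8) ∷ []) ∷
    ((# 0 , # 0) ∷ (# 2 , # 0) ∷ (# 2 , # 8) ∷ []) ∷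
    ((# 2 , # 0) ∷ (# 3 , # 9) ∷ (# 4 , # 3) ∷ []) ∷
    ((# 3 , # 0) ∷ (# 3 , # 3) ∷ (# 5 , # 0) ∷ []) ∷
    ((# 0 , # 0) ∷ (# 3 , # 2) ∷ (# 5 , # 3) ∷ []) ∷
    ((# 0 , # 0) ∷ (# 1 , # 0) ∷ (# 6 , # 4) ∷ []) ∷
    ((# 0 , # 0) ∷ (# 2 , # 1) ∷ (# 2 , # 4) ∷ []) ∷
    ((# 1 , # 0) ∷ (# 2 , # 3) ∷ (# 6 , # 6) ∷ []) ∷
    ((# 2 , # 0) ∷ (# 4 , # 0) ∷ (# 6 , # 4) ∷ []) ∷
    ((# 2 , # 0) ∷ (# 2 , # 1) ∷ (# 4 , # 2) ∷ []) ∷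
    ((# 0 , # 0) ∷ (# 1 , # 1) ∷ (# 4 , # 9) ∷ []) ∷
    ((# 0 , # 0) ∷ (# 3 , # 3) ∷ (# 6 , # 6) ∷ []) ∷
    ((# 1 , # 0) ∷ (# 3 , # 7) ∷ (# 6 , # 8) ∷ []) ∷
    ((# 3 , # 0) ∷ (# 4 , # 0) ∷ (# 4 , # 8) ∷ []) ∷
    ((# 0 , # 0) ∷ (# 3 , # 4) ∷ (# 4 , # 6) ∷ []) ∷
    ((# 4 , # 0) ∷ (# 5 , # 1) ∷ (# 5 , # 9) ∷ []) ∷
    ((# 0 , # 0) ∷ (# 3 , # 5) ∷ (# 4 , # 4) ∷ []) ∷
    ((# 4 , # 0) ∷ (# 5 , # 4) ∷ (# 6 , # 0) ∷ []) ∷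
    ((# 0 , # 0) ∷ (# 6 , # 0) ∷ (# 6 , # 3) ∷ []) ∷
    ((# 0 , # 0) ∷ (# 1 , # 2) ∷ (# 6 , # 9) ∷ []) ∷
    ((# 0 , # 0) ∷ (# 6 , # 1) ∷ (# 6 , # 5) ∷ []) ∷
    ((# 1 , # 0) ∷ (# 4 , # 0) ∷ (# 5 , # 3) ∷ []) ∷
    ((# 3 , # 0) ∷ (# 4 , # 3) ∷ (# 4 , # 7) ∷ []) ∷
    ((# 1 , # 0) ∷ (# 2 , # 6) ∷ (# 4 , # 3) ∷ []) ∷
    ((# 0 , # 0) ∷ (# 3 , # 6) ∷ (# 5 , # 4) ∷ []) ∷
    ((# 2 , # 0) ∷ (# 4 , # 4) ∷ (# 6 , # 6) ∷ []) ∷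
    ((# 0 , # 0) ∷ (# 3 , # 7) ∷ (# 3 , # 9) ∷ []) ∷
    ((# 2 , # 0) ∷ (# 4 , # 5) ∷ (# 6 , # 2) ∷ []) ∷
    ((# 0 , # 0) ∷ (# 1 , # 3) ∷ (# 5 , # 9) ∷ []) ∷
    ((# 2 , # 0) ∷ (# 2 , # 4) ∷ (# 5 , # 1) ∷ []) ∷
    ((# 4 , # 0) ∷ (# 6 , # 1) ∷ (# 6 , # 3) ∷ []) ∷
    ((# 3 , # 0) ∷ (# 4 , # 5) ∷ (# 6 , # 4) ∷ []) ∷
    ((# 0 , # 0) ∷ (# 1 , # 4) ∷ (# 5 , # 6) ∷ []) ∷
    []

c10 : List (List (Point 10 10))
c10 =
    ((# 4 , # 0) ∷ (# 6 , # 7) ∷ (# 9 , # 2) ∷ []) ∷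
    ((# 2 , # 0) ∷ (# 3 , # 2) ∷ (# 6 , # 0) ∷ []) ∷
    ((# 1 , # 0) ∷ (# 6 , # 5) ∷ (# 6 , # 7) ∷ []) ∷
    ((# 0 , # 0) ∷ (# 4 , # 9) ∷ (# 7 , # 9) ∷ []) ∷
    ((# 1 , # 0) ∷ (# 4 , # 2) ∷ (# 8 , # 4) ∷ []) ∷
    ((# 2 , # 0) ∷ (# 5 , # 0) ∷ (# 8 , # 6) ∷ []) ∷
    ((# 0 , # 0) ∷ (# 0 , # 1) ∷ (# 5 , # 7) ∷ []) ∷
    ((# 0 , # 0) ∷ (# 3 , # 2) ∷ (# 6 , # 6) ∷ []) ∷
    ((# 2 , # 0) ∷ (# 3 , # 3) ∷ (# 3 , # 9) ∷ []) ∷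
    ((# 2 , # 0) ∷ (# 8 , # 3) ∷ (# 8 , # 5) ∷ []) ∷
    ((# 0 , # 0) ∷ (# 1 , # 8) ∷ (# 6 , # 7) ∷ []) ∷
    ((# 3 , # 0) ∷ (# 5 , # 2) ∷ (# 7 , # 7) ∷ []) ∷
    ((# 3 , # 0) ∷ (# 8 , # 8) ∷ (# 9 , # 2) ∷ []) ∷
    ((# 5 , # 0) ∷ (# 7 , # 3) ∷ (# 7 , # 7) ∷ []) ∷
    ((# 7 , # 0) ∷ (# 8 , # 3) ∷ (# 9 , # 3) ∷ []) ∷
    ((# 0 , # 0) ∷ (# 1 , # 9) ∷ (# 2 , # 1) ∷ []) ∷
    ((# 0 , # 0) ∷ (# 3 , # 3) ∷ (# 4 , # 0) ∷ []) ∷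
    ((# 0 , # 0) ∷ (# 0 , # 2) ∷ (# 2 , # 0) ∷ []) ∷
    ((# 0 , # 0) ∷ (# 8 , # 3) ∷ (# 9 , # 2) ∷ []) ∷
    ((# 5 , # 0) ∷ (# 7 , # 4) ∷ (# 9 , # 3) ∷ []) ∷
    ((# 3 , # 0) ∷ (# 9 , # 3) ∷ (# 9 , # 7) ∷ []) ∷
    ((# 1 , # 0) ∷ (# 2 , # 7) ∷ (# 9 , # 2) ∷ []) ∷
    ((# 1 , # 0) ∷ (# 6 , # 8) ∷ (# 7 , # 7) ∷ []) ∷
    ((# 1 , # 0) ∷ (# 2 , # 8) ∷ (# 3 , # 2) ∷ []) ∷
    ((# 4 , # 0) ∷ (# 4 , # 1) ∷ (# 5 , # 2) ∷ []) ∷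
    ((# 1 , # 0) ∷ (# 4 , # 4) ∷ (# 7 , # 6) ∷ []) ∷
    ((# 2 , # 0) ∷ (# 5 , # 2) ∷ (# 8 , # 4) ∷ []) ∷
    ((# 5 , # 0) ∷ (# 7 , # 6) ∷ (# 9 , # 4) ∷ []) ∷
    ((# 2 , # 0) ∷ (# 9 , # 2) ∷ (# 9 , # 4) ∷ []) ∷
    ((# 0 , # 0) ∷ (# 8 , # 8) ∷ (# 9 , # 3) ∷ []) ∷
    ((# 4 , # 0) ∷ (# 7 , # 3) ∷ (# 7 , # 6) ∷ []) ∷
    ((# 1 , # 0) ∷ (# 4 , # 5) ∷ (# 5 , # 5) ∷ []) ∷
    ((# 3 , # 0) ∷ (# 5 , # 4) ∷ (# 9 , # 4) ∷ []) ∷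
    ((# 1 , # 0) ∷ (# 7 , # 0) ∷ (# 8 , # 0) ∷ []) ∷
    ((# 2 , # 0) ∷ (# 3 , # 5) ∷ (# 4 , # 1) ∷ []) ∷
    ((# 8 , # 0) ∷ (# 8 , # 1) ∷ (# 9 , # 3) ∷ []) ∷
    ((# 2 , # 0) ∷ (# 5 , # 4) ∷ (# 5 , # 6) ∷ []) ∷
    ((# 4 , # 0) ∷ (# 7 , # 4) ∷ (# 8 , # 5) ∷ []) ∷
    ((# 0 , # 0) ∷ (# 9 , # 4) ∷ (# 9 , # 5) ∷ []) ∷
    ((# 5 , # 0) ∷ (# 7 , # 9) ∷ (# 8 , # 8) ∷ []) ∷
    ((# 1 , # 0) ∷ (# 7 , # 1) ∷ (# 8 , # 7) ∷ []) ∷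
    ((# 0 , # 0) ∷ (# 5 , # 3) ∷ (# 8 , # 4) ∷ []) ∷
    ((# 1 , # 0) ∷ (# 1 , # 1) ∷ (# 3 , # 7) ∷ []) ∷
    ((# 0 , # 0) ∷ (# 0 , # 3) ∷ (# 7 , # 8) ∷ []) ∷
    ((# 0 , # 0) ∷ (# 3 , # 5) ∷ (# 8 , # 1) ∷ []) ∷
    ((# 4 , # 0) ∷ (# 4 , # 3) ∷ (# 9 , # 3) ∷ []) ∷
    ((# 3 , # 0) ∷ (# 3 , # 2) ∷ (# 7 , # 1) ∷ []) ∷
    ((# 2 , # 0) ∷ (# 3 , # 6) ∷ (# 7 , # 0) ∷ []) ∷
    ((# 4 , # 0) ∷ (# 7 , # 8) ∷ (# 8 , # 0) ∷ []) ∷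
    ((# 1 , # 0) ∷ (# 4 , # 7) ∷ (# 7 , # 4) ∷ []) ∷
    ((# 5 , # 0) ∷ (# 8 , # 4) ∷ (# 9 , # 5) ∷ []) ∷
    ((# 4 , # 0) ∷ (# 4 , # 4) ∷ (# 7 , # 5) ∷ []) ∷
    ((# 1 , # 0) ∷ (# 3 , # 0) ∷ (# 7 , # 2) ∷ []) ∷
    ((# 3 , # 0) ∷ (# 5 , # 7) ∷ (# 9 , # 9) ∷ []) ∷
    ((# 4 , # 0) ∷ (# 7 , # 9) ∷ (# 8 , # 6) ∷ []) ∷
    ((# 3 , # 0) ∷ (# 5 , # 8) ∷ (# 7 , # 8) ∷ []) ∷
    ((# 0 , # 0) ∷ (# 2 , # 2) ∷ (# 3 , # 0) ∷ []) ∷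
    ((# 0 , # 0) ∷ (# 0 , # 4) ∷ (# 7 , # 7) ∷ []) ∷
    ((# 0 , # 0) ∷ (# 3 , # 6) ∷ (# 9 , # 1) ∷ []) ∷
    ((# 1 , # 0) ∷ (# 3 , # 1) ∷ (# 4 , # 6) ∷ []) ∷
    ((# 2 , # 0) ∷ (# 5 , # 7) ∷ (# 7 , # 8) ∷ []) ∷
    ((# 0 , # 0) ∷ (# 3 , # 7) ∷ (# 4 , # 7) ∷ []) ∷
    ((# 3 , # 0) ∷ (# 5 , # 9) ∷ (# 8 , # 2) ∷ []) ∷
    ((# 2 , # 0) ∷ (# 3 , # 7) ∷ (# 9 , # 8) ∷ []) ∷
    ((# 1 , # 0) ∷ (# 1 , # 2) ∷ (# 8 , # 5) ∷ []) ∷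
    ((# 1 , # 0) ∷ (# 4 , # 9) ∷ (# 6 , # 3) ∷ []) ∷
    ((# 0 , # 0) ∷ (# 1 , # 0) ∷ (# 4 , # 8) ∷ []) ∷
    ((# 2 , # 0) ∷ (# 5 , # 8) ∷ (# 8 , # 8) ∷ []) ∷
    ((# 5 , # 0) ∷ (# 9 , # 6) ∷ (# 9 , # 9) ∷ []) ∷
    ((# 1 , # 0) ∷ (# 7 , # 9) ∷ (# 9 , # 1) ∷ []) ∷
    ((# 6 , # 0) ∷ (# 6 , # 1) ∷ (# 7 , # 1) ∷ []) ∷
    ((# 0 , # 0) ∷ (# 3 , # 8) ∷ (# 6 , # 1) ∷ []) ∷
    ((# 0 , # 0) ∷ (# 5 , # 8) ∷ (# 9 , # 6) ∷ []) ∷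
    ((# 1 , # 0) ∷ (# 1 , # 3) ∷ (# 7 , # 8) ∷ []) ∷
    ((# 0 , # 0) ∷ (# 2 , # 3) ∷ (# 8 , # 2) ∷ []) ∷
    ((# 1 , # 0) ∷ (# 8 , # 2) ∷ (# 9 , # 8) ∷ []) ∷
    ((# 3 , # 0) ∷ (# 6 , # 2) ∷ (# 8 , # 3) ∷ []) ∷
    ((# 0 , # 0) ∷ (# 1 , # 1) ∷ (# 5 , # 2) ∷ []) ∷
    ((# 1 , # 0) ∷ (# 3 , # 3) ∷ (# 6 , # 2) ∷ []) ∷
    ((# 3 , # 0) ∷ (# 4 , # 1) ∷ (# 4 , # 3) ∷ []) ∷
    ((# 0 , # 0) ∷ (# 3 , # 9) ∷ (# 7 , # 4) ∷ []) ∷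
    ((# 0 , # 0) ∷ (# 2 , # 4) ∷ (# 6 , # 0) ∷ []) ∷
    ((# 1 , # 0) ∷ (# 8 , # 6) ∷ (# 9 , # 3) ∷ []) ∷
    ((# 1 , # 0) ∷ (# 1 , # 4) ∷ (# 9 , # 0) ∷ []) ∷
    ((# 4 , # 0) ∷ (# 5 , # 4) ∷ (# 8 , # 9) ∷ []) ∷
    ((# 1 , # 0) ∷ (# 2 , # 0) ∷ (# 2 , # 1) ∷ []) ∷
    ((# 2 , # 0) ∷ (# 6 , # 2) ∷ (# 8 , # 7) ∷ []) ∷
    ((# 1 , # 0) ∷ (# 5 , # 2) ∷ (# 8 , # 9) ∷ []) ∷
    ((# 1 , # 0) ∷ (# 3 , # 4) ∷ (# 5 , # 9) ∷ []) ∷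
    ((# 0 , # 0) ∷ (# 2 , # 5) ∷ (# 5 , # 4) ∷ []) ∷
    ((# 4 , # 0) ∷ (# 5 , # 5) ∷ (# 8 , # 4) ∷ []) ∷
    ((# 3 , # 0) ∷ (# 6 , # 5) ∷ (# 8 , # 7) ∷ []) ∷
    ((# 3 , # 0) ∷ (# 4 , # 2) ∷ (# 9 , # 0) ∷ []) ∷
    ((# 5 , # 0) ∷ (# 5 , # 3) ∷ (# 6 , # 6) ∷ []) ∷
    ((# 2 , # 0) ∷ (# 6 , # 3) ∷ (# 9 , # 9) ∷ []) ∷
    ((# 2 , # 0) ∷ (# 6 , # 4) ∷ (# 7 , # 1) ∷ []) ∷
    ((# 4 , # 0) ∷ (# 5 , # 6) ∷ (# 6 , # 8) ∷ []) ∷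
    ((# 1 , # 0) ∷ (# 3 , # 5) ∷ (# 5 , # 6) ∷ []) ∷
    ((# 0 , # 0) ∷ (# 1 , # 2) ∷ (# 9 , # 9) ∷ []) ∷
    ((# 3 , # 0) ∷ (# 6 , # 6) ∷ (# 8 , # 5) ∷ []) ∷
    ((# 2 , # 0) ∷ (# 4 , # 2) ∷ (# 5 , # 5) ∷ []) ∷
    ((# 0 , # 0) ∷ (# 6 , # 3) ∷ (# 9 , # 7) ∷ []) ∷
    ((# 6 , # 0) ∷ (# 7 , # 3) ∷ (# 9 , # 8) ∷ []) ∷
    ((# 0 , # 0) ∷ (# 4 , # 1) ∷ (# 9 , # 0) ∷ []) ∷
    ((# 0 , # 0) ∷ (# 2 , # 6) ∷ (# 4 , # 5) ∷ []) ∷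
    ((# 3 , # 0) ∷ (# 4 , # 4) ∷ (# 5 , # 3) ∷ []) ∷
    ((# 6 , # 0) ∷ (# 7 , # 5) ∷ (# 9 , # 1) ∷ []) ∷
    ((# 5 , # 0) ∷ (# 6 , # 0) ∷ (# 7 , # 2) ∷ []) ∷
    ((# 0 , # 0) ∷ (# 4 , # 2) ∷ (# 8 , # 0) ∷ []) ∷
    ((# 4 , # 0) ∷ (# 5 , # 8) ∷ (# 6 , # 3) ∷ []) ∷
    ((# 0 , # 0) ∷ (# 6 , # 5) ∷ (# 8 , # 9) ∷ []) ∷
    ((# 2 , # 0) ∷ (# 2 , # 2) ∷ (# 5 , # 3) ∷ []) ∷
    ((# 6 , # 0) ∷ (# 7 , # 6) ∷ (# 9 , # 0) ∷ []) ∷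
    ((# 0 , # 0) ∷ (# 1 , # 3) ∷ (# 9 , # 8) ∷ []) ∷
    ((# 0 , # 0) ∷ (# 4 , # 3) ∷ (# 5 , # 0) ∷ []) ∷
    ((# 5 , # 0) ∷ (# 6 , # 1) ∷ (# 6 , # 7) ∷ []) ∷
    ((# 1 , # 0) ∷ (# 5 , # 7) ∷ (# 5 , # 8) ∷ []) ∷
    ((# 3 , # 0) ∷ (# 7 , # 0) ∷ (# 8 , # 4) ∷ []) ∷
    ((# 0 , # 0) ∷ (# 2 , # 7) ∷ (# 7 , # 1) ∷ []) ∷
    ((# 2 , # 0) ∷ (# 2 , # 3) ∷ (# 4 , # 3) ∷ []) ∷
    ((# 2 , # 0) ∷ (# 4 , # 4) ∷ (# 8 , # 1) ∷ []) ∷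
    ((# 6 , # 0) ∷ (# 8 , # 0) ∷ (# 8 , # 6) ∷ []) ∷
    ((# 0 , # 0) ∷ (# 6 , # 8) ∷ (# 7 , # 6) ∷ []) ∷
    ((# 0 , # 0) ∷ (# 1 , # 4) ∷ (# 8 , # 5) ∷ []) ∷
    ((# 2 , # 0) ∷ (# 6 , # 9) ∷ (# 8 , # 2) ∷ []) ∷
    ((# 1 , # 0) ∷ (# 3 , # 8) ∷ (# 3 , # 9) ∷ []) ∷
    ((# 0 , # 0) ∷ (# 4 , # 4) ∷ (# 8 , # 7) ∷ []) ∷
    ((# 4 , # 0) ∷ (# 6 , # 0) ∷ (# 9 , # 7) ∷ []) ∷
    ((# 0 , # 0) ∷ (# 6 , # 9) ∷ (# 8 , # 6) ∷ []) ∷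
    ((# 3 , # 0) ∷ (# 7 , # 3) ∷ (# 8 , # 1) ∷ []) ∷
    ((# 2 , # 0) ∷ (# 4 , # 5) ∷ (# 9 , # 1) ∷ []) ∷
    ((# 5 , # 0) ∷ (# 6 , # 4) ∷ (# 7 , # 8) ∷ []) ∷
    ((# 0 , # 0) ∷ (# 7 , # 0) ∷ (# 7 , # 2) ∷ []) ∷
    ((# 0 , # 0) ∷ (# 1 , # 5) ∷ (# 5 , # 5) ∷ []) ∷
    ((# 1 , # 0) ∷ (# 2 , # 3) ∷ (# 9 , # 9) ∷ []) ∷
    ((# 2 , # 0) ∷ (# 7 , # 2) ∷ (# 9 , # 3) ∷ []) ∷
    ((# 4 , # 0) ∷ (# 6 , # 2) ∷ (# 9 , # 5) ∷ []) ∷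
    ((# 2 , # 0) ∷ (# 4 , # 6) ∷ (# 9 , # 7) ∷ []) ∷
    ((# 0 , # 0) ∷ (# 4 , # 6) ∷ (# 6 , # 2) ∷ []) ∷
    ((# 0 , # 0) ∷ (# 2 , # 9) ∷ (# 6 , # 4) ∷ []) ∷
    ((# 1 , # 0) ∷ (# 6 , # 0) ∷ (# 8 , # 8) ∷ []) ∷
    ((# 2 , # 0) ∷ (# 7 , # 3) ∷ (# 9 , # 0) ∷ []) ∷
    ((# 1 , # 0) ∷ (# 6 , # 1) ∷ (# 6 , # 4) ∷ []) ∷
    ((# 3 , # 0) ∷ (# 7 , # 6) ∷ (# 9 , # 6) ∷ []) ∷
    ((# 1 , # 0) ∷ (# 2 , # 4) ∷ (# 7 , # 3) ∷ []) ∷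
    ((# 2 , # 0) ∷ (# 3 , # 0) ∷ (# 6 , # 1) ∷ []) ∷
    ((# 3 , # 0) ∷ (# 4 , # 8) ∷ (# 8 , # 9) ∷ []) ∷
    ((# 0 , # 0) ∷ (# 1 , # 6) ∷ (# 5 , # 9) ∷ []) ∷
    ((# 2 , # 0) ∷ (# 7 , # 5) ∷ (# 8 , # 0) ∷ []) ∷
    ((# 1 , # 0) ∷ (# 2 , # 5) ∷ (# 2 , # 9) ∷ []) ∷
    ((# 3 , # 0) ∷ (# 4 , # 9) ∷ (# 6 , # 0) ∷ []) ∷
    ((# 2 , # 0) ∷ (# 7 , # 6) ∷ (# 7 , # 7) ∷ []) ∷
    ((# 2 , # 0) ∷ (# 4 , # 8) ∷ (# 6 , # 7) ∷ []) ∷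
    ((# 1 , # 0) ∷ (# 4 , # 0) ∷ (# 9 , # 4) ∷ []) ∷
    ((# 5 , # 0) ∷ (# 6 , # 8) ∷ (# 9 , # 7) ∷ []) ∷
    ((# 3 , # 0) ∷ (# 5 , # 0) ∷ (# 5 , # 6) ∷ []) ∷
    ((# 2 , # 0) ∷ (# 3 , # 1) ∷ (# 6 , # 8) ∷ []) ∷
    ((# 3 , # 0) ∷ (# 8 , # 0) ∷ (# 9 , # 8) ∷ []) ∷
    ((# 1 , # 0) ∷ (# 4 , # 1) ∷ (# 6 , # 6) ∷ []) ∷
    ((# 0 , # 0) ∷ (# 3 , # 1) ∷ (# 3 , # 4) ∷ []) ∷
    ((# 0 , # 0) ∷ (# 1 , # 7) ∷ (# 5 , # 1) ∷ []) ∷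
    ((# 5 , # 0) ∷ (# 6 , # 9) ∷ (# 9 , # 1) ∷ []) ∷
    ((# 1 , # 0) ∷ (# 2 , # 6) ∷ (# 4 , # 3) ∷ []) ∷
    []


opaque
  unfolding _-ₙ_

  c7-isOOC : IsOOC 7 10 3 c7
  c7-isOOC = uniqueRowDiffs⇒IsOOC (from-yes (ksubsets? 3 c7)) (from-yes (uniqueRowDiffs? c7))

  c10-isOOC : IsOOC 10 10 3 c10
  c10-isOOC = uniqueRowDiffs⇒IsOOC (from-yes (ksubsets? 3 c10)) (from-yes (uniqueRowDiffs? c10))

lemma8p5 : (m : ℕ) → (m ≡ 7 ⊎ m ≡ 10) →
    Σ (List (List (Point m 10))) (λ C →
      IsOptimalOOC m 10 3 C × length C ≡ J* m 10)
lemma8p5 .7  (inj₁ refl) = c7 , meetsJ⇒optimal c7-isOOC refl , refl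
lemma8p5 .10 (inj₂ refl) = c10 , meetsJ⇒optimal c10-isOOC refl , refl
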